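{- Let $q$ be a prime power, $n$ a positive integer and $F=\mathbb{F}_{q^{2n+1}}$. Consider the projective space $\mathrm{PG}(4n+1,q)$ whose points are the $1$-dimensional $\mathbb{F}_q$-subspaces of the $\mathbb{F}_q$-vector space $F\times F$; write $P(a,b)$ for the point spanned by $(a,b)\ne(0,0)$. For $\omega\in F^*$ let $\mathcal{V}_\omega=\{P(x^2,\omega x^{q+1}):x\in F^*\}$. Then $\mathcal{V}_\omega$ is a cap, i.e. no three of its points are collinear.
   Context: Three points of the projective space are collinear iff spanning vectors of them are $\mathbb{F}_q$-linearly dependent. -}

module Defs where

open import Level using (Level; _⊔_)
open import Data.Nat using (ℕ; _≤_; _^_)
open import Data.Nat.Primality using (Prime)
open import Data.Fin using (Fin)
open import Data.Product using (Σ; ∃; _×_; _,_)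
open import Data.Sum using (_⊎_)
open import Relation.Nullary using (¬_)
open import Relation.Binary.PropositionalEquality using (_≡_)
open import Algebra.Bundles using (CommutativeRing; Semiring)
import Algebra.Definitions.RawSemiring as RS

private
  variable
    c ℓ : Level

IsPrimePower : ℕ → Set
IsPrimePower q = Σ ℕ λ p → Σ ℕ λ k → Prime p × 1 ≤ k × q ≡ p ^ k

record IsField (R : CommutativeRing c ℓ) : Set (c ⊔ ℓ) where
  open CommutativeRing R
  field
    1≉0     : ¬ (1# ≈ 0#)
    inverse : ∀ x → ¬ (x ≈ 0#) → ∃ λ y → (x * y) ≈ 1#

HasCard : (R : CommutativeRing c ℓ) → ℕ → Set (c ⊔ ℓ)
HasCard R m = Σ (Fin m → Carrier) λ f →
    (∀ i j → f i ≈ f j → i ≡ j) × (∀ x → ∃ λ i → f i ≈ x)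
  where open CommutativeRing R

module _ (R : CommutativeRing c ℓ) where
  open CommutativeRing R
  open RS (Semiring.rawSemiring semiring) using () renaming (_^_ to _^ᴿ_)

  pow : Carrier → ℕ → Carrier
  pow = _^ᴿ_

  InFq : ℕ → Carrier → Set ℓ
  InFq q x = pow x q ≈ x

  Vec2 : Set c
  Vec2 = Carrier × Carrier

  _≈v_ : Vec2 → Vec2 → Set ℓ
  (a , b) ≈v (a' , b') = (a ≈ a') × (b ≈ b')

  0v : Vec2
  0v = (0# , 0#)

  _·v_ : Carrier → Vec2 → Vec2
  t ·v (a , b) = (t * a , t * b)

  _+v_ : Vec2 → Vec2 → Vec2
  (a , b) +v (a' , b') = (a + a' , b + b')

  SamePoint : ℕ → Vec2 → Vec2 → Set (c ⊔ ℓ)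
  SamePoint q u v = ∃ λ t → InFq q t × ¬ (t ≈ 0#) × (v ≈v (t ·v u))

  Collinear : ℕ → Vec2 → Vec2 → Vec2 → Set (c ⊔ ℓ)
  Collinear q u v w = ∃ λ r → ∃ λ s → ∃ λ t →
    InFq q r × InFq q s × InFq q t ×
    (¬ (r ≈ 0#) ⊎ ¬ (s ≈ 0#) ⊎ ¬ (t ≈ 0#)) ×
    (((r ·v u) +v (s ·v v)) +v (t ·v w)) ≈v 0v

  vω : ℕ → Carrier → Carrier → Vec2
  vω q ω x = (pow x 2 , ω * pow x (q Data.Nat.+ 1))

-- A field of order p^N has characteristic p, so σ x = x^q is additive as well as multiplicative.
-- A dependence r v(x) + s v(y) + t v(z) = 0 with r, s, t ∈ F_q gives Σ r x² = 0 and Σ r σ(x) x = 0,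
-- and applying σ to the first gives Σ r σ(x)² = 0. Put twist u v = σ(u) v − u σ(v); it vanishes
-- exactly when v/u ∈ F_q, and then v(u) and v(v) span the same point. Weighting the three relations
-- by σ(z)², −2zσ(z), z² (and the first two by −σ(z), z) eliminates the z-terms, leaving
-- r A² + s B² = 0 and r x A + s y B = 0 for A = twist x z, B = twist y z, hence r A z · twist x y = 0.
-- So if r ≠ 0, two of the points coincide; rotating x, y, z brings a nonzero coefficient first.

module Submission where

open import Defs
open import Level using (_⊔_)
open import Algebra.Bundles using (CommutativeRing)
open import Algebra.Solver.Ring.AlmostCommutativeRing using (fromCommutativeRing; _-Raw-AlmostCommutative⟶_)
open import Data.Nat as ℕ using (ℕ; zero; suc)
import Data.Nat.Properties as ℕ
open import Data.Nat.Divisibility using (_∣_; divides; ∣1⇒≡1; ∣⇒≤; m∣m*n)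
open import Data.Nat.DivMod using (m/n*n≡m)
open import Data.Nat.Primality using (Prime; euclidsLemma; ¬prime[0]; ¬prime[1])
open import Data.Nat.Combinatorics using (_C_; nCn≡1; nCk≡n!/k![n-k]!; k![n∸k]!∣n!)
open import Data.Integer as ℤ using (ℤ; +_; -[1+_]; sign; ∣_∣; _◃_)
import Data.Integer.Properties as ℤ
open import Data.Sign as Sign using (Sign)
open import Data.Fin as Fin using (Fin; toℕ; fromℕ; inject₁)
open import Data.Fin.Properties using (toℕ-fromℕ; toℕ-inject₁; toℕ<n)
open import Data.Fin.Permutation using (permutation)
open import Data.Vec.Functional using (init; tail; last)
open import Data.Maybe using (Maybe; just; nothing)
open import Data.Product using (_,_; proj₁; proj₂)
open import Data.Sum using (_⊎_; inj₁; inj₂; [_,_])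
open import Data.Empty using (⊥-elim)
open import Function using (id; _∘_)
open import Relation.Nullary using (¬_; yes; no; contradiction)
open import Relation.Nullary.Decidable using (¬¬-excluded-middle)
open import Relation.Binary.PropositionalEquality as ≡ using (_≡_)

-- Tactic.RingSolver takes its coefficients from the carrier, where 1# - 1# ≈ 0# is not decided
-- for an abstract ring; with coefficients in ℤ the normal forms can be compared.
module IntegerCoefficientSolver {c ℓ} (R : CommutativeRing c ℓ) where
  open CommutativeRing R
  open import Algebra.Properties.Ring ring
    using (-0#≈0#; -‿involutive; -‿distribˡ-*; -‿distribʳ-*; -‿+-comm)
  open import Algebra.Properties.Semiring.Mult semiring using (_×_; ×-homo-+; ×1-homo-*)
  open import Algebra.Properties.CommutativeSemigroup +-commutativeSemigroup using (interchange)
  open import Relation.Binary.Reasoning.Setoid setoid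

  signed : Sign → Carrier → Carrier
  signed Sign.+ a = a
  signed Sign.- a = - a

  signed-cong : ∀ s {a b} → a ≈ b → signed s a ≈ signed s b
  signed-cong Sign.+ a≈b = a≈b
  signed-cong Sign.- a≈b = -‿cong a≈b

  signed-* : ∀ s t a b → signed (s Sign.* t) (a * b) ≈ signed s a * signed t b
  signed-* Sign.+ Sign.+ a b = refl
  signed-* Sign.+ Sign.- a b = -‿distribʳ-* a b
  signed-* Sign.- Sign.+ a b = -‿distribˡ-* a b
  signed-* Sign.- Sign.- a b = begin
    a * b           ≈⟨ -‿involutive (a * b) ⟨
    - (- (a * b))   ≈⟨ -‿cong (-‿distribˡ-* a b) ⟩
    - (- a * b)     ≈⟨ -‿distribʳ-* (- a) b ⟩
    - a * - b       ∎

  ⟦_⟧ℤ : ℤ → Carrier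
  ⟦ i ⟧ℤ = signed (sign i) (∣ i ∣ × 1#)

  ⟦◃⟧ : ∀ s n → ⟦ s ◃ n ⟧ℤ ≈ signed s (n × 1#)
  ⟦◃⟧ Sign.+ zero    = refl
  ⟦◃⟧ Sign.- zero    = sym -0#≈0#
  ⟦◃⟧ Sign.+ (suc n) = refl
  ⟦◃⟧ Sign.- (suc n) = refl

  ⟦⊖⟧ : ∀ m n → ⟦ m ℤ.⊖ n ⟧ℤ ≈ m × 1# - n × 1#
  ⟦⊖⟧ m zero rewrite ℤ.⊖-≥ (ℕ.z≤n {m}) = begin
    m × 1#         ≈⟨ +-identityʳ (m × 1#) ⟨
    m × 1# + 0#    ≈⟨ +-congˡ -0#≈0# ⟨
    m × 1# - 0#    ∎
  ⟦⊖⟧ zero (suc n) = sym (+-identityˡ _)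
  ⟦⊖⟧ (suc m) (suc n) rewrite ℤ.[1+m]⊖[1+n]≡m⊖n m n = begin
    ⟦ m ℤ.⊖ n ⟧ℤ                       ≈⟨ ⟦⊖⟧ m n ⟩
    m × 1# - n × 1#                    ≈⟨ +-identityˡ _ ⟨
    0# + (m × 1# - n × 1#)             ≈⟨ +-congʳ (-‿inverseʳ 1#) ⟨
    (1# - 1#) + (m × 1# - n × 1#)      ≈⟨ interchange 1# (m × 1#) (- 1#) (- (n × 1#)) ⟨
    (1# + m × 1#) + (- 1# - n × 1#)    ≈⟨ +-congˡ (-‿+-comm 1# (n × 1#)) ⟩
    (1# + m × 1#) - (1# + n × 1#)      ∎

  +-homo : ∀ i j → ⟦ i ℤ.+ j ⟧ℤ ≈ ⟦ i ⟧ℤ + ⟦ j ⟧ℤ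
  +-homo -[1+ m ] -[1+ n ] = begin
    - (suc (suc (m ℕ.+ n)) × 1#)         ≡⟨ ≡.cong (λ k → - (k × 1#)) (ℕ.+-suc (suc m) n) ⟨
    - ((suc m ℕ.+ suc n) × 1#)           ≈⟨ -‿cong (×-homo-+ 1# (suc m) (suc n)) ⟩
    - (suc m × 1# + suc n × 1#)          ≈⟨ -‿+-comm _ _ ⟨
    - (suc m × 1#) - suc n × 1#          ∎
  +-homo -[1+ m ] (+ n)    = trans (⟦⊖⟧ n (suc m)) (+-comm _ _)
  +-homo (+ m)    -[1+ n ] = ⟦⊖⟧ m (suc n)
  +-homo (+ m)    (+ n)    = ×-homo-+ 1# m n

  *-homo : ∀ i j → ⟦ i ℤ.* j ⟧ℤ ≈ ⟦ i ⟧ℤ * ⟦ j ⟧ℤ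
  *-homo i j = begin
    ⟦ s ◃ ∣ i ∣ ℕ.* ∣ j ∣ ⟧ℤ                ≈⟨ ⟦◃⟧ s (∣ i ∣ ℕ.* ∣ j ∣) ⟩
    signed s ((∣ i ∣ ℕ.* ∣ j ∣) × 1#)      ≈⟨ signed-cong s (×1-homo-* ∣ i ∣ ∣ j ∣) ⟩
    signed s (∣ i ∣ × 1# * ∣ j ∣ × 1#)     ≈⟨ signed-* (sign i) (sign j) _ _ ⟩
    ⟦ i ⟧ℤ * ⟦ j ⟧ℤ                        ∎
    where
    s = sign i Sign.* sign j

  -‿homo : ∀ i → ⟦ ℤ.- i ⟧ℤ ≈ - ⟦ i ⟧ℤ
  -‿homo -[1+ n ]  = sym (-‿involutive _)
  -‿homo (+ zero)  = sym -0#≈0#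
  -‿homo (+ suc n) = refl

  homomorphism : ℤ.+-*-rawRing -Raw-AlmostCommutative⟶ fromCommutativeRing R
  homomorphism = record
    { ⟦_⟧ = ⟦_⟧ℤ ; +-homo = +-homo ; *-homo = *-homo ; -‿homo = -‿homo
    ; 0-homo = refl ; 1-homo = +-identityʳ 1# }

  ⟦⟧-≟ : ∀ i j → Maybe (⟦ i ⟧ℤ ≈ ⟦ j ⟧ℤ)
  ⟦⟧-≟ i j with i ℤ.≟ j
  ... | yes ≡.refl = just refl
  ... | no _       = nothing

  open import Algebra.Solver.Ring ℤ.+-*-rawRing (fromCommutativeRing R) homomorphism ⟦⟧-≟ public


module FieldProperties {c ℓ} (R : CommutativeRing c ℓ) (F : IsField R) where
  open CommutativeRing R
  open IsField F
  open IntegerCoefficientSolver R using (solve; _:*_; _:=_)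
  open import Algebra.Properties.Ring ring using (x[y-z]≈xy-xz; x≈y⇒x∙y⁻¹≈ε; x∙y⁻¹≈ε⇒x≈y)
  open import Algebra.Properties.Semiring.Mult semiring using (_×_; ×1-homo-*)
  open import Relation.Binary.Reasoning.Setoid setoid

  x*y≈0⇒y≈0 : ∀ {x y} → x ≉ 0# → x * y ≈ 0# → y ≈ 0#
  x*y≈0⇒y≈0 {x} {y} x≉0 x*y≈0 with inverse x x≉0
  ... | x⁻¹ , x*x⁻¹≈1 = begin
    y               ≈⟨ *-identityʳ y ⟨
    y * 1#          ≈⟨ *-congˡ x*x⁻¹≈1 ⟨
    y * (x * x⁻¹)   ≈⟨ solve 3 (λ x y x⁻¹ → y :* (x :* x⁻¹) := x⁻¹ :* (x :* y)) refl x y x⁻¹ ⟩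
    x⁻¹ * (x * y)   ≈⟨ *-congˡ x*y≈0 ⟩
    x⁻¹ * 0#        ≈⟨ zeroʳ x⁻¹ ⟩
    0#              ∎

  *-nonzero : ∀ {x y} → x ≉ 0# → y ≉ 0# → x * y ≉ 0#
  *-nonzero x≉0 y≉0 x*y≈0 = y≉0 (x*y≈0⇒y≈0 x≉0 x*y≈0)

  x*y≈1⇒x≉0 : ∀ {x y} → x * y ≈ 1# → x ≉ 0#
  x*y≈1⇒x≉0 {x} {y} x*y≈1 x≈0 = 1≉0 (trans (sym x*y≈1) (trans (*-congʳ x≈0) (zeroˡ y)))

  *-cancelˡ : ∀ {x y z} → x ≉ 0# → x * y ≈ x * z → y ≈ z
  *-cancelˡ {x} {y} {z} x≉0 x*y≈x*z =
    x∙y⁻¹≈ε⇒x≈y y z (x*y≈0⇒y≈0 x≉0 (trans (x[y-z]≈xy-xz x y z) (x≈y⇒x∙y⁻¹≈ε x*y≈x*z)))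

  [m^n]×1≈0⇒¬¬m×1≈0 : ∀ m n → (m ℕ.^ n) × 1# ≈ 0# → ¬ ¬ (m × 1# ≈ 0#)
  [m^n]×1≈0⇒¬¬m×1≈0 m zero    1×1≈0     _       = 1≉0 (trans (sym (+-identityʳ 1#)) 1×1≈0)
  [m^n]×1≈0⇒¬¬m×1≈0 m (suc n) m^[1+n]×1≈0 m×1≉0 =
    [m^n]×1≈0⇒¬¬m×1≈0 m n (x*y≈0⇒y≈0 m×1≉0 (trans (sym (×1-homo-* m (m ℕ.^ n))) m^[1+n]×1≈0)) m×1≉0

module FiniteRing {c ℓ} (R : CommutativeRing c ℓ) where
  open CommutativeRing R
  open IntegerCoefficientSolver R using (solve; _:+_; _:-_; _:=_)
  open import Algebra.Properties.Ring ring using (+-identityʳ-unique)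
  open import Algebra.Properties.Semiring.Mult semiring using (_×_)
  open import Algebra.Properties.Semiring.Sum semiring using (sum; sum-permute; sum-cong-≋; ∑-distrib-+; sum-replicate)
  open import Relation.Binary.Reasoning.Setoid setoid

  -- Translation by 1 permutes the elements, so it does not change their sum.
  card×1≈0 : ∀ {m} → HasCard R m → m × 1# ≈ 0#
  card×1≈0 {m} (enum , enum-injective , enum-surjective) =
    +-identityʳ-unique (sum enum) (m × 1#) (sym sum≈sum+m×1)
    where
    index : Carrier → Fin m
    index a = proj₁ (enum-surjective a)

    enum∘index : ∀ a → enum (index a) ≈ a
    enum∘index a = proj₂ (enum-surjective a)

    index-cong : ∀ {a b} → a ≈ b → index a ≡ index b
    index-cong {a} {b} a≈b = enum-injective _ _ (trans (enum∘index a) (trans a≈b (sym (enum∘index b))))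

    index∘enum : ∀ i → index (enum i) ≡ i
    index∘enum i = enum-injective _ _ (enum∘index (enum i))

    shift unshift : Fin m → Fin m
    shift i = index (enum i + 1#)
    unshift i = index (enum i - 1#)

    shift∘unshift : ∀ i → shift (unshift i) ≡ i
    shift∘unshift i = ≡.trans (index-cong (trans (+-congʳ (enum∘index _)) (x-y+y≈x (enum i) 1#))) (index∘enum i)
      where
      x-y+y≈x : ∀ x y → x - y + y ≈ x
      x-y+y≈x = solve 2 (λ x y → x :- y :+ y := x) refl

    unshift∘shift : ∀ i → unshift (shift i) ≡ i
    unshift∘shift i = ≡.trans (index-cong (trans (+-congʳ (enum∘index _)) (x+y-y≈x (enum i) 1#))) (index∘enum i)
      where
      x+y-y≈x : ∀ x y → x + y - y ≈ x
      x+y-y≈x = solve 2 (λ x y → x :+ y :- y := x) refl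

    sum≈sum+m×1 : sum enum ≈ sum enum + m × 1#
    sum≈sum+m×1 = begin
      sum enum                          ≈⟨ sum-permute enum (permutation shift unshift shift∘unshift unshift∘shift) ⟩
      sum (enum ∘ shift)                ≈⟨ sum-cong-≋ {m} (λ i → enum∘index _) ⟩
      sum {m} (λ i → enum i + 1#)       ≈⟨ ∑-distrib-+ {m} enum (λ _ → 1#) ⟩
      sum enum + sum {m} (λ _ → 1#)     ≈⟨ +-congˡ (sum-replicate m) ⟩
      sum enum + m × 1#                 ∎

nCk*[k!*[n∸k]!]≡n! : ∀ {n k} → k ℕ.≤ n → (n C k) ℕ.* (k ℕ.! ℕ.* (n ℕ.∸ k) ℕ.!) ≡ n ℕ.!
nCk*[k!*[n∸k]!]≡n! {n} {k} k≤n = ≡.trans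
  (≡.cong (ℕ._* (k ℕ.! ℕ.* (n ℕ.∸ k) ℕ.!)) (nCk≡n!/k![n-k]! k≤n))
  (m/n*n≡m {{k ℕ.!* (n ℕ.∸ k) !≢0}} (k![n∸k]!∣n! k≤n))

prime∤! : ∀ {p j} → Prime p → j ℕ.< p → ¬ p ∣ j ℕ.!
prime∤! {j = zero}  p-prime _     p∣1 = ¬prime[1] (≡.subst Prime (∣1⇒≡1 p∣1) p-prime)
prime∤! {j = suc j} p-prime j+1<p p∣[j+1]! with euclidsLemma (suc j) (j ℕ.!) p-prime p∣[j+1]!
... | inj₁ p∣j+1 = ℕ.<⇒≱ j+1<p (∣⇒≤ p∣j+1)
... | inj₂ p∣j!  = prime∤! p-prime (ℕ.<-trans (ℕ.n<1+n j) j+1<p) p∣j!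

prime∣pCk : ∀ {p k} → Prime p → 0 ℕ.< k → k ℕ.< p → p ∣ p C k
prime∣pCk {zero} p-prime = contradiction p-prime ¬prime[0]
prime∣pCk {p@(suc p-1)} {k} p-prime 0<k k<p =
  [ id , ⊥-elim ∘ [ prime∤! p-prime k<p , prime∤! p-prime p∸k<p ] ∘ euclidsLemma _ _ p-prime ]
    (euclidsLemma (p C k) _ p-prime p∣pCk*[k!*[p∸k]!])
  where
  p∸k<p : p ℕ.∸ k ℕ.< p
  p∸k<p = ℕ.∸-monoʳ-< 0<k (ℕ.<⇒≤ k<p)

  p∣pCk*[k!*[p∸k]!] : p ∣ (p C k) ℕ.* (k ℕ.! ℕ.* (p ℕ.∸ k) ℕ.!)
  p∣pCk*[k!*[p∸k]!] = ≡.subst (p ∣_) (≡.sym (nCk*[k!*[n∸k]!]≡n! (ℕ.<⇒≤ k<p))) (m∣m*n (p-1 ℕ.!))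

module Frobenius {c ℓ} (R : CommutativeRing c ℓ) where
  open CommutativeRing R
  open import Algebra.Properties.Semiring.Exp semiring using (_^_; ^-congˡ; ^-assocʳ)
  open import Algebra.Properties.Semiring.Mult semiring using (_×_; ×-congʳ; ×-assoc-*; ×1-homo-*)
  open import Algebra.Properties.Semiring.Sum semiring using (sum; sum-init-last; sum-cong-≋; sum-replicate-zero)
  open import Algebra.Properties.CommutativeSemiring.Binomial commutativeSemiring using (theorem; binomialTerm)
  open import Relation.Binary.Reasoning.Setoid setoid

  Additive : ℕ → Set (c ⊔ ℓ)
  Additive e = ∀ a b → (a + b) ^ e ≈ a ^ e + b ^ e

  ^-additive : ∀ {e} → Additive e → ∀ k → Additive (e ℕ.^ k)
  ^-additive _ zero a b = trans (*-identityʳ (a + b)) (sym (+-cong (*-identityʳ a) (*-identityʳ b)))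
  ^-additive {e} additive (suc k) a b = begin
    (a + b) ^ (e ℕ.* e ℕ.^ k)                   ≈⟨ ^-assocʳ (a + b) e (e ℕ.^ k) ⟨
    ((a + b) ^ e) ^ (e ℕ.^ k)                   ≈⟨ ^-congˡ (e ℕ.^ k) (additive a b) ⟩
    (a ^ e + b ^ e) ^ (e ℕ.^ k)                 ≈⟨ ^-additive additive k (a ^ e) (b ^ e) ⟩
    (a ^ e) ^ (e ℕ.^ k) + (b ^ e) ^ (e ℕ.^ k)   ≈⟨ +-cong (^-assocʳ a e (e ℕ.^ k)) (^-assocʳ b e (e ℕ.^ k)) ⟩
    a ^ (e ℕ.* e ℕ.^ k) + b ^ (e ℕ.* e ℕ.^ k)   ∎

  p∣n⇒n×x≈0 : ∀ {p n} → p × 1# ≈ 0# → ∀ x → p ∣ n → n × x ≈ 0#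
  p∣n⇒n×x≈0 {p} p×1≈0 x (divides d ≡.refl) = begin
    (d ℕ.* p) × x             ≈⟨ ×-congʳ (d ℕ.* p) (*-identityˡ x) ⟨
    (d ℕ.* p) × (1# * x)      ≈⟨ ×-assoc-* (d ℕ.* p) 1# x ⟨
    ((d ℕ.* p) × 1#) * x      ≈⟨ *-congʳ (×1-homo-* d p) ⟩
    (d × 1#) * (p × 1#) * x   ≈⟨ *-congʳ (*-congˡ p×1≈0) ⟩
    (d × 1#) * 0# * x         ≈⟨ *-congʳ (zeroʳ (d × 1#)) ⟩
    0# * x                    ≈⟨ zeroˡ x ⟩
    0#                        ∎

  binomialTerm-last : ∀ a b n → binomialTerm a b n (fromℕ n) ≈ a ^ n
  binomialTerm-last a b n rewrite toℕ-fromℕ n | nCn≡1 n | ℕ.n∸n≡0 n = trans (+-identityʳ _) (*-identityʳ _)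

  frobenius : ∀ {p} → Prime p → p × 1# ≈ 0# → Additive p
  frobenius {zero}    p-prime = contradiction p-prime ¬prime[0]
  frobenius {p@(suc m)} p-prime p×1≈0 a b = begin
    (a + b) ^ p                                 ≈⟨ theorem p a b ⟩
    sum T                                       ≈⟨ sum-init-last T ⟩
    T Fin.zero + sum (tail (init T)) + last T
      ≈⟨ +-cong (+-cong first-term (sum-cong-≋ middle-term)) (binomialTerm-last a b p) ⟩
    b ^ p + sum {m} (λ _ → 0#) + a ^ p
      ≈⟨ +-congʳ (trans (+-congˡ (sum-replicate-zero m)) (+-identityʳ (b ^ p))) ⟩
    b ^ p + a ^ p                               ≈⟨ +-comm (b ^ p) (a ^ p) ⟩
    a ^ p + b ^ p                               ∎
    where
    T : Fin (suc p) → Carrier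
    T = binomialTerm a b p

    first-term : T Fin.zero ≈ b ^ p
    first-term = trans (+-identityʳ _) (*-identityˡ _)

    middle-term : ∀ j → T (Fin.suc (inject₁ j)) ≈ 0#
    middle-term j = p∣n⇒n×x≈0 p×1≈0 _ (prime∣pCk p-prime (ℕ.s≤s ℕ.z≤n) (ℕ.s≤s k<m))
      where
      k<m : toℕ (inject₁ j) ℕ.< m
      k<m = ≡.subst (ℕ._< m) (≡.sym (toℕ-inject₁ j)) (toℕ<n j)


module CapArgument {c ℓ} (R : CommutativeRing c ℓ) (F : IsField R) (q : ℕ)
  (^q-additive : Frobenius.Additive R q) where
  open CommutativeRing R
  open IsField F
  open FieldProperties R F
  open IntegerCoefficientSolver R using (solve; _:+_; _:*_; _:-_; :-_; _:=_)
  open import Algebra.Properties.Ring ring using (x+x≈x⇒x≈0; x≈y⇒x∙y⁻¹≈ε; x∙y⁻¹≈ε⇒x≈y)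
  open import Algebra.Properties.Semiring.Exp semiring using (^-congˡ; ^-homo-*)
  open import Algebra.Properties.CommutativeSemiring.Exp commutativeSemiring using (^-distrib-*)
  open import Relation.Binary.Reasoning.Setoid setoid

  σ : Carrier → Carrier
  σ a = pow R a q

  σ-cong : ∀ {a b} → a ≈ b → σ a ≈ σ b
  σ-cong = ^-congˡ q

  σ-* : ∀ a b → σ (a * b) ≈ σ a * σ b
  σ-* a b = ^-distrib-* a b q

  σ-0 : σ 0# ≈ 0#
  σ-0 = x+x≈x⇒x≈0 (σ 0#) (trans (sym (^q-additive 0# 0#)) (σ-cong (+-identityʳ 0#)))

  σ-1 : σ 1# ≈ 1#
  σ-1 = 1#^n≈1# q
    where
    1#^n≈1# : ∀ n → pow R 1# n ≈ 1#
    1#^n≈1# zero    = refl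
    1#^n≈1# (suc n) = trans (*-identityˡ _) (1#^n≈1# n)

  pow-2 : ∀ a → pow R a 2 ≈ a * a
  pow-2 a = *-congˡ (*-identityʳ a)

  pow-q+1 : ∀ a → pow R a (q ℕ.+ 1) ≈ σ a * a
  pow-q+1 a = trans (^-homo-* a q 1) (*-congˡ (*-identityʳ a))

  scaled⇒samePoint : ∀ ω {u v l} → σ l ≈ l → l ≉ 0# → v ≈ l * u → SamePoint R q (vω R q ω u) (vω R q ω v)
  scaled⇒samePoint ω {u} {v} {l} σl≈l l≉0 v≈lu = l * l , σ[l*l]≈l*l , *-nonzero l≉0 l≉0 , first , second
    where
    σ[l*l]≈l*l : σ (l * l) ≈ l * l
    σ[l*l]≈l*l = trans (σ-* l l) (*-cong σl≈l σl≈l)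

    first : pow R v 2 ≈ (l * l) * pow R u 2
    first = begin
      pow R v 2               ≈⟨ pow-2 v ⟩
      v * v                   ≈⟨ *-cong v≈lu v≈lu ⟩
      (l * u) * (l * u)       ≈⟨ solve 2 (λ l u → (l :* u) :* (l :* u) := (l :* l) :* (u :* u)) refl l u ⟩
      (l * l) * (u * u)       ≈⟨ *-congˡ (pow-2 u) ⟨
      (l * l) * pow R u 2     ∎

    second : ω * pow R v (q ℕ.+ 1) ≈ (l * l) * (ω * pow R u (q ℕ.+ 1))
    second = begin
      ω * pow R v (q ℕ.+ 1)             ≈⟨ *-congˡ (pow-q+1 v) ⟩
      ω * (σ v * v)                     ≈⟨ *-congˡ (*-cong (trans (σ-cong v≈lu) (σ-* l u)) v≈lu) ⟩
      ω * ((σ l * σ u) * (l * u))       ≈⟨ *-congˡ (*-congʳ (*-congʳ σl≈l)) ⟩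
      ω * ((l * σ u) * (l * u))
        ≈⟨ solve 4 (λ ω l σu u → ω :* ((l :* σu) :* (l :* u)) := (l :* l) :* (ω :* (σu :* u))) refl ω l (σ u) u ⟩
      (l * l) * (ω * (σ u * u))         ≈⟨ *-congˡ (*-congˡ (pow-q+1 u)) ⟨
      (l * l) * (ω * pow R u (q ℕ.+ 1)) ∎

  twist : Carrier → Carrier → Carrier
  twist u v = σ u * v - u * σ v

  twist-sym : ∀ {u v} → twist u v ≈ 0# → twist v u ≈ 0#
  twist-sym {u} {v} twist≈0 = x≈y⇒x∙y⁻¹≈ε (begin
    σ v * u   ≈⟨ *-comm (σ v) u ⟩
    u * σ v   ≈⟨ x∙y⁻¹≈ε⇒x≈y _ _ twist≈0 ⟨
    σ u * v   ≈⟨ *-comm (σ u) v ⟩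
    v * σ u   ∎)

  twist-cocycle : ∀ x y z → z * twist x y ≈ y * twist x z - x * twist y z
  twist-cocycle x y z = solve 6
    (λ x y z σx σy σz → z :* (σx :* y :- x :* σy) := y :* (σx :* z :- x :* σz) :- x :* (σy :* z :- y :* σz))
    refl x y z (σ x) (σ y) (σ z)

  twist≈0⇒samePoint : ∀ ω {u v} → u ≉ 0# → v ≉ 0# → twist u v ≈ 0# → SamePoint R q (vω R q ω u) (vω R q ω v)
  twist≈0⇒samePoint ω {u} {v} u≉0 v≉0 twist≈0 with inverse u u≉0
  ... | u⁻¹ , u*u⁻¹≈1 = scaled⇒samePoint ω σl≈l l≉0 v≈l*u
    where
    l = v * u⁻¹

    σu*σu⁻¹≈1 : σ u * σ u⁻¹ ≈ 1#
    σu*σu⁻¹≈1 = trans (sym (σ-* u u⁻¹)) (trans (σ-cong u*u⁻¹≈1) σ-1)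

    l≉0 : l ≉ 0#
    l≉0 = *-nonzero v≉0 (x*y≈1⇒x≉0 (trans (*-comm u⁻¹ u) u*u⁻¹≈1))

    v≈l*u : v ≈ l * u
    v≈l*u = begin
      v               ≈⟨ *-identityʳ v ⟨
      v * 1#          ≈⟨ *-congˡ u*u⁻¹≈1 ⟨
      v * (u * u⁻¹)   ≈⟨ solve 3 (λ v u u⁻¹ → v :* (u :* u⁻¹) := (v :* u⁻¹) :* u) refl v u u⁻¹ ⟩
      l * u           ∎

    σl≈l : σ l ≈ l
    σl≈l = *-cancelˡ (x*y≈1⇒x≉0 σu*σu⁻¹≈1) (begin
      σ u * σ l                 ≈⟨ *-congˡ (σ-* v u⁻¹) ⟩
      σ u * (σ v * σ u⁻¹)       ≈⟨ solve 3 (λ a b c → a :* (b :* c) := b :* (a :* c)) refl (σ u) (σ v) (σ u⁻¹) ⟩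
      σ v * (σ u * σ u⁻¹)       ≈⟨ *-congˡ σu*σu⁻¹≈1 ⟩
      σ v * 1#                  ≈⟨ *-congˡ u*u⁻¹≈1 ⟨
      σ v * (u * u⁻¹)           ≈⟨ solve 3 (λ a b c → a :* (b :* c) := (b :* a) :* c) refl (σ v) u u⁻¹ ⟩
      (u * σ v) * u⁻¹           ≈⟨ *-congʳ (x∙y⁻¹≈ε⇒x≈y _ _ twist≈0) ⟨
      (σ u * v) * u⁻¹           ≈⟨ *-assoc (σ u) v u⁻¹ ⟩
      σ u * l                   ∎)

  combination : (Carrier → Carrier) → (r s t x y z : Carrier) → Carrier
  combination f r s t x y z = r * f x + s * f y + t * f z

  square norm : Carrier → Carrier
  square a = a * a
  norm a = σ a * a

  module _ {r s t x y z : Carrier} where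

    combination-cong : ∀ {f g} → (∀ a → f a ≈ g a) → combination f r s t x y z ≈ combination g r s t x y z
    combination-cong f≈g = +-cong (+-cong (*-congˡ (f≈g x)) (*-congˡ (f≈g y))) (*-congˡ (f≈g z))

    combination-rotate : ∀ f → combination f r s t x y z ≈ combination f s t r y z x
    combination-rotate f = solve 6 (λ r s t a b c → r :* a :+ s :* b :+ t :* c := s :* b :+ t :* c :+ r :* a)
      refl r s t (f x) (f y) (f z)

    *-distribˡ-combination : ∀ w f → w * combination f r s t x y z ≈ combination (λ a → w * f a) r s t x y z
    *-distribˡ-combination w f = solve 7
      (λ w r s t a b c → w :* (r :* a :+ s :* b :+ t :* c) := r :* (w :* a) :+ s :* (w :* b) :+ t :* (w :* c))
      refl w r s t (f x) (f y) (f z)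

    σ-combination : ∀ f → σ r ≈ r → σ s ≈ s → σ t ≈ t →
                    σ (combination f r s t x y z) ≈ combination (σ ∘ f) r s t x y z
    σ-combination f σr≈r σs≈s σt≈t = begin
      σ (r * f x + s * f y + t * f z)                 ≈⟨ ^q-additive _ _ ⟩
      σ (r * f x + s * f y) + σ (t * f z)             ≈⟨ +-congʳ (^q-additive _ _) ⟩
      σ (r * f x) + σ (s * f y) + σ (t * f z)         ≈⟨ +-cong (+-cong (fixed σr≈r) (fixed σs≈s)) (fixed σt≈t) ⟩
      r * σ (f x) + s * σ (f y) + t * σ (f z)         ∎
      where
      fixed : ∀ {k a} → σ k ≈ k → σ (k * a) ≈ k * σ a
      fixed {k} {a} σk≈k = trans (σ-* k a) (*-congʳ σk≈k)

  ax+by≈0 : ∀ a b {x y} → x ≈ 0# → y ≈ 0# → a * x + b * y ≈ 0#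
  ax+by≈0 a b x≈0 y≈0 = trans (+-cong (trans (*-congˡ x≈0) (zeroʳ a)) (trans (*-congˡ y≈0) (zeroʳ b))) (+-identityʳ 0#)

  ax+by+cz≈0 : ∀ a b c {x y z} → x ≈ 0# → y ≈ 0# → z ≈ 0# → a * x + b * y + c * z ≈ 0#
  ax+by+cz≈0 a b c x≈0 y≈0 z≈0 =
    trans (+-cong (ax+by≈0 a b x≈0 y≈0) (trans (*-congˡ z≈0) (zeroʳ c))) (+-identityʳ 0#)

  twist-dichotomy : ∀ {r s t x y z} → r ≉ 0# → z ≉ 0# → σ r ≈ r → σ s ≈ s → σ t ≈ t →
                    combination square r s t x y z ≈ 0# → combination norm r s t x y z ≈ 0# →
                    ¬ ¬ (twist x y ≈ 0# ⊎ twist x z ≈ 0#)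
  twist-dichotomy {r} {s} {t} {x} {y} {z} r≉0 z≉0 σr≈r σs≈s σt≈t E₁ E₂ refute = ¬¬-excluded-middle λ where
      (yes A≈0) → refute (inj₂ A≈0)
      (no A≉0)  → refute (inj₁ (x*y≈0⇒y≈0 z≉0 (x*y≈0⇒y≈0 (*-nonzero r≉0 A≉0) rA[z*twist[x,y]]≈0)))
    where
    A B : Carrier
    A = twist x z
    B = twist y z

    E₃ : combination square r s t (σ x) (σ y) (σ z) ≈ 0#
    E₃ = begin
      combination (square ∘ σ) r s t x y z  ≈⟨ combination-cong (λ a → σ-* a a) ⟨
      combination (σ ∘ square) r s t x y z  ≈⟨ σ-combination square σr≈r σs≈s σt≈t ⟨
      σ (combination square r s t x y z)    ≈⟨ σ-cong E₁ ⟩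
      σ 0#                                  ≈⟨ σ-0 ⟩
      0#                                    ∎

    quadratic : r * (A * A) + s * (B * B) ≈ 0#
    quadratic = begin
      r * (A * A) + s * (B * B)
        ≈⟨ solve 9 (λ r s t x y z σx σy σz →
             r :* ((σx :* z :- x :* σz) :* (σx :* z :- x :* σz)) :+ s :* ((σy :* z :- y :* σz) :* (σy :* z :- y :* σz))
             := (z :* z) :* (r :* (σx :* σx) :+ s :* (σy :* σy) :+ t :* (σz :* σz))
                :+ (:- (z :* σz :+ z :* σz)) :* (r :* (σx :* x) :+ s :* (σy :* y) :+ t :* (σz :* z))
                :+ (σz :* σz) :* (r :* (x :* x) :+ s :* (y :* y) :+ t :* (z :* z)))
             refl r s t x y z (σ x) (σ y) (σ z) ⟩
      (z * z) * combination square r s t (σ x) (σ y) (σ z) + (- (z * σ z + z * σ z)) * combination norm r s t x y z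
        + (σ z * σ z) * combination square r s t x y z
        ≈⟨ ax+by+cz≈0 _ _ _ E₃ E₂ E₁ ⟩
      0# ∎

    linear : r * (x * A) + s * (y * B) ≈ 0#
    linear = begin
      r * (x * A) + s * (y * B)
        ≈⟨ solve 9 (λ r s t x y z σx σy σz →
             r :* (x :* (σx :* z :- x :* σz)) :+ s :* (y :* (σy :* z :- y :* σz))
             := z :* (r :* (σx :* x) :+ s :* (σy :* y) :+ t :* (σz :* z))
                :+ (:- σz) :* (r :* (x :* x) :+ s :* (y :* y) :+ t :* (z :* z)))
             refl r s t x y z (σ x) (σ y) (σ z) ⟩
      z * combination norm r s t x y z + (- σ z) * combination square r s t x y z
        ≈⟨ ax+by≈0 _ _ E₂ E₁ ⟩
      0# ∎

    rA[z*twist[x,y]]≈0 : r * A * (z * twist x y) ≈ 0#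
    rA[z*twist[x,y]]≈0 = begin
      r * A * (z * twist x y)     ≈⟨ *-congˡ (twist-cocycle x y z) ⟩
      r * A * (y * A - x * B)
        ≈⟨ solve 6 (λ r s x y a b →
             r :* a :* (y :* a :- x :* b)
             := y :* (r :* (a :* a) :+ s :* (b :* b)) :+ (:- b) :* (r :* (x :* a) :+ s :* (y :* b)))
             refl r s x y A B ⟩
      y * (r * (A * A) + s * (B * B)) + (- B) * (r * (x * A) + s * (y * B))
        ≈⟨ ax+by≈0 _ _ quadratic linear ⟩
      0# ∎

  cap : ∀ {ω x y z} → ω ≉ 0# → x ≉ 0# → y ≉ 0# → z ≉ 0# →
        ¬ SamePoint R q (vω R q ω x) (vω R q ω y) →
        ¬ SamePoint R q (vω R q ω x) (vω R q ω z) →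
        ¬ SamePoint R q (vω R q ω y) (vω R q ω z) →
        ¬ Collinear R q (vω R q ω x) (vω R q ω y) (vω R q ω z)
  cap {ω} {x} {y} {z} ω≉0 x≉0 y≉0 z≉0 x≁y x≁z y≁z (r , s , t , σr≈r , σs≈s , σt≈t , nontrivial , e₁ , e₂) =
    [ (λ r≉0 → twist-dichotomy r≉0 z≉0 σr≈r σs≈s σt≈t E₁ E₂
                 [ apart x≉0 y≉0 x≁y , apart x≉0 z≉0 x≁z ])
    , [ (λ s≉0 → twist-dichotomy s≉0 x≉0 σs≈s σt≈t σr≈r (rotate square E₁) (rotate norm E₂)
                   [ apart y≉0 z≉0 y≁z , apart x≉0 y≉0 x≁y ∘ twist-sym ])
      , (λ t≉0 → twist-dichotomy t≉0 y≉0 σt≈t σr≈r σs≈s (rotate square (rotate square E₁))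
                                                   (rotate norm (rotate norm E₂))
                   [ apart x≉0 z≉0 x≁z ∘ twist-sym , apart y≉0 z≉0 y≁z ∘ twist-sym ])
      ]
    ] nontrivial
    where
    apart : ∀ {u v} → u ≉ 0# → v ≉ 0# → ¬ SamePoint R q (vω R q ω u) (vω R q ω v) → ¬ twist u v ≈ 0#
    apart u≉0 v≉0 u≁v = u≁v ∘ twist≈0⇒samePoint ω u≉0 v≉0

    rotate : ∀ f {r s t x y z} → combination f r s t x y z ≈ 0# → combination f s t r y z x ≈ 0#
    rotate f = trans (sym (combination-rotate f))

    E₁ : combination square r s t x y z ≈ 0#
    E₁ = trans (sym (combination-cong pow-2)) e₁

    E₂ : combination norm r s t x y z ≈ 0#
    E₂ = x*y≈0⇒y≈0 ω≉0 (begin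
      ω * combination norm r s t x y z                        ≈⟨ *-distribˡ-combination ω norm ⟩
      combination (λ a → ω * norm a) r s t x y z              ≈⟨ combination-cong (λ a → *-congˡ (pow-q+1 a)) ⟨
      combination (λ a → ω * pow R a (q ℕ.+ 1)) r s t x y z   ≈⟨ e₂ ⟩
      0#                                                      ∎)


open import Data.Nat using (_≤_; _^_; _+_; _*_)

proposition3p3 : ∀ {c ℓ} (q n : ℕ) → IsPrimePower q → 1 ≤ n →
    (R : CommutativeRing c ℓ) → IsField R → HasCard R (q ^ (2 * n + 1)) →
    (ω : CommutativeRing.Carrier R) → ¬ (CommutativeRing._≈_ R ω (CommutativeRing.0# R)) →
    (x y z : CommutativeRing.Carrier R) →
    ¬ (CommutativeRing._≈_ R x (CommutativeRing.0# R)) → ¬ (CommutativeRing._≈_ R y (CommutativeRing.0# R)) → ¬ (CommutativeRing._≈_ R z (CommutativeRing.0# R)) →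
    ¬ SamePoint R q (vω R q ω x) (vω R q ω y) →
    ¬ SamePoint R q (vω R q ω x) (vω R q ω z) →
    ¬ SamePoint R q (vω R q ω y) (vω R q ω z) →
    ¬ Collinear R q (vω R q ω x) (vω R q ω y) (vω R q ω z)
proposition3p3 .(p ^ k) n (p , k , p-prime , _ , ≡.refl) _ R F card ω ω≉0 x y z x≉0 y≉0 z≉0 x≁y x≁z y≁z collinear =
  [m^n]×1≈0⇒¬¬m×1≈0 p (k * (2 * n + 1)) (card×1≈0 (≡.subst (HasCard R) (ℕ.^-*-assoc p k (2 * n + 1)) card))
    λ p×1≈0 → CapArgument.cap R F (p ^ k) (^-additive (frobenius p-prime p×1≈0) k)
                ω≉0 x≉0 y≉0 z≉0 x≁y x≁z y≁z collinear
  where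
  open FieldProperties R F
  open FiniteRing R
  open Frobenius R
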